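{- Let $p\equiv 1\pmod 6$ be a prime and $a\in\mathbb{F}_p^{*}$. Let $N_{p,a}$ be the number of $\mathbb{F}_p$-rational points (including the point at infinity) of the curve $y^{2}=x^{3}+a^{3}$ over $\mathbb{F}_p$. Then $N_{p,a}\equiv 0\pmod 6$ or $N_{p,a}\equiv 4\pmod 6$.
   Context: $N_{p,a}$ counts the solutions $(x,y)\in\mathbb{F}_p^2$ of $y^2=x^3+a^3$ plus one point at infinity. -}

module Defs where

open import Data.Nat using (ℕ; suc; _+_; _*_; _^_; NonZero)
open import Data.Nat.DivMod using (_%_)
open import Data.Fin using (Fin; toℕ)
open import Data.List using (List; length; filter; allFin; cartesianProduct)
open import Data.Product using (_×_; _,_)
open import Data.Nat.Properties using (_≟_)
open import Relation.Unary using (Decidable)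
open import Relation.Binary.PropositionalEquality using (_≡_)

-- Elements of 𝔽_p are represented by Fin p (residues 0..p-1); arithmetic mod p.
-- (x , y) is an affine point of y² = x³ + a³ over 𝔽_p iff y² ≡ x³ + a³ (mod p).
OnCurve : (p : ℕ) → .{{_ : NonZero p}} → ℕ → Fin p × Fin p → Set
OnCurve p a (x , y) = (toℕ y ^ 2) % p ≡ (toℕ x ^ 3 + a ^ 3) % p

onCurve? : (p : ℕ) → .{{_ : NonZero p}} → (a : ℕ) → Decidable (OnCurve p a)
onCurve? p a (x , y) = ((toℕ y ^ 2) % p) ≟ ((toℕ x ^ 3 + a ^ 3) % p)

-- N_{p,a}: number of affine solutions (x,y) ∈ 𝔽_p² plus one point at infinity.
N : (p : ℕ) → .{{_ : NonZero p}} → ℕ → ℕ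
N p a = suc (length (filter (onCurve? p a) (cartesianProduct (allFin p) (allFin p))))

-- Write N = 1 + n, n the number of affine points. The involution (x, y) ↦ (x, -y) fixes exactly
-- the points (x, 0) with x³ = -α³ (here α = a); apart from (-α, 0) these are the roots of
-- x² - αx + α², which x ↦ α - x pairs off without fixed points, so n is odd. Since p ≡ 1 (mod 3),
-- counting the fixed points of an order-3 map on (𝔽_p^*)² yields a cube root of unity ω ≠ 1,
-- and (x, y) ↦ (ωx, y) has order 3 and fixes exactly the 0 or 2 points (0, y) with y² = α³.
-- Hence n is odd and n ≡ 0 or 2 (mod 3), i.e. N ≡ 0 or 4 (mod 6).
module Submission where

open import Defs
open import Data.Nat using (ℕ; _%_; _<_; NonZero)
open import Data.Nat.Primality using (Prime)
open import Data.Sum using (_⊎_)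
open import Relation.Binary.PropositionalEquality using (_≡_)

import Data.Nat as ℕ
import Data.Nat.Properties as ℕₚ
open import Data.Nat using (zero; suc; z≤n; s≤s)
import Data.Integer as ℤ
open import Data.Product using (∃; ∃-syntax; _×_; _,_; proj₁; proj₂)
import Data.Product as Product
open import Data.Sum using (inj₁; inj₂; [_,_]′)
import Data.Sum as Sum
open import Data.Fin as Fin using (Fin; toℕ)
open import Data.List using (List; []; _∷_; length; filter; map; allFin; cartesianProduct)
open import Data.List.Properties using (filter-none; filter-≐; filter-all; filter-++; length-++; length-tabulate)
open import Data.List.Membership.Propositional using (_∈_)
open import Data.List.Relation.Unary.All as All using (All; []; _∷_)
open import Data.List.Relation.Unary.Any using (here; there)
open import Data.List.Relation.Unary.AllPairs using ([]; _∷_)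
open import Data.List.Relation.Unary.Unique.Propositional using (Unique)
open import Function using (_∘_; id)
open import Data.Empty using (⊥-elim)
open import Level using (0ℓ)
open import Relation.Nullary using (¬_; yes; no; contradiction)
open import Relation.Unary using (Pred; Decidable; _⊆_; _≐_; _∩_; _∖_; ∁; _⊢_; _⟨×⟩_)
open import Relation.Unary.Properties using (U?; _∩?_; ∁?; _×?_)
open import Relation.Binary.Definitions using (DecidableEquality)
open import Relation.Binary.PropositionalEquality
  using (_≢_; refl; sym; trans; cong; cong₂; subst; module ≡-Reasoning)

-- Counting by filtering a duplicate-free listing

module _ {A : Set} {P Q : Pred A 0ℓ} (P? : Decidable P) (Q? : Decidable Q) where

  open import Data.Nat using (_+_)

  length-filter-split : ∀ xs →
    length (filter P? xs) ≡ length (filter (P? ∩? Q?) xs) + length (filter (P? ∩? ∁? Q?) xs)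
  length-filter-split []       = refl
  length-filter-split (x ∷ xs) with P? x | Q? x
  ... | yes _ | yes _ = cong suc (length-filter-split xs)
  ... | yes _ | no  _ = trans (cong suc (length-filter-split xs)) (sym (ℕₚ.+-suc _ _))
  ... | no  _ | _     = length-filter-split xs

module _ {A B : Set} {P : Pred A 0ℓ} {Q : Pred B 0ℓ} (P? : Decidable P) (Q? : Decidable Q) where

  open import Data.Nat using (_+_; _*_)

  private
    filter-row : ∀ {x} → P x → ∀ ys →
      length (filter (P? ×? Q?) (map (x ,_) ys)) ≡ length (filter Q? ys)
    filter-row Px [] = refl
    filter-row {x} Px (y ∷ ys) with P? x | Q? y
    ... | yes _  | yes _ = cong suc (filter-row Px ys)
    ... | yes _  | no  _ = filter-row Px ys
    ... | no ¬Px | _     = contradiction Px ¬Px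

    filter-row-∅ : ∀ {x} → ¬ P x → ∀ ys → length (filter (P? ×? Q?) (map (x ,_) ys)) ≡ 0
    filter-row-∅ ¬Px [] = refl
    filter-row-∅ {x} ¬Px (y ∷ ys) with P? x
    ... | yes Px = contradiction Px ¬Px
    ... | no  _  = filter-row-∅ ¬Px ys

    filter-rows : ∀ x xs ys → length (filter (P? ×? Q?) (cartesianProduct (x ∷ xs) ys)) ≡
      length (filter (P? ×? Q?) (map (x ,_) ys)) + length (filter (P? ×? Q?) (cartesianProduct xs ys))
    filter-rows x xs ys = trans (cong length (filter-++ (P? ×? Q?) (map (x ,_) ys) _))
                                (length-++ (filter (P? ×? Q?) (map (x ,_) ys)))

  length-filter-cartesianProduct : ∀ xs ys →
    length (filter (P? ×? Q?) (cartesianProduct xs ys)) ≡ length (filter P? xs) * length (filter Q? ys)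
  length-filter-cartesianProduct []       ys = refl
  length-filter-cartesianProduct (x ∷ xs) ys with P? x
  ... | yes Px = trans (filter-rows x xs ys)
                       (cong₂ _+_ (filter-row Px ys) (length-filter-cartesianProduct xs ys))
  ... | no ¬Px = trans (filter-rows x xs ys)
                       (cong₂ _+_ (filter-row-∅ ¬Px ys) (length-filter-cartesianProduct xs ys))

length-filter-≟ : ∀ {A : Set} (_≟_ : DecidableEquality A) {x : A} {xs} →
  Unique xs → x ∈ xs → length (filter (_≟ x) xs) ≡ 1
length-filter-≟ _≟_ {x} (x∉ys ∷ _) (here refl) with x ≟ x
... | yes _  = cong suc (cong length (filter-none (_≟ x) (All.map (λ x≢y y≡x → x≢y (sym y≡x)) x∉ys)))
... | no x≢x = contradiction refl x≢x
length-filter-≟ _≟_ {x} {y ∷ _} (y∉ys ∷ ys-unique) (there x∈ys) with y ≟ x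
... | yes y≡x = contradiction y≡x (All.lookup y∉ys x∈ys)
... | no  _   = length-filter-≟ _≟_ ys-unique x∈ys

module Counting {A : Set} (_≟_ : DecidableEquality A) (elements : List A)
                (elements-unique : Unique elements) (elements-complete : ∀ x → x ∈ elements) where

  open import Data.Nat using (_+_; _*_; _≤_)
  open import Data.List.Membership.DecPropositional _≟_ using (_∈?_)
  open import Data.List.Membership.Propositional.Properties using (∈-filter⁻)
  open ≡-Reasoning

  count : {P : Pred A 0ℓ} → Decidable P → ℕ
  count P? = length (filter P? elements)

  Fixed : (A → A) → Pred A 0ℓ
  Fixed σ x = σ x ≡ x

  fixed? : (σ : A → A) → Decidable (Fixed σ)
  fixed? σ x = σ x ≟ x

  count-cong : ∀ {P Q : Pred A 0ℓ} (P? : Decidable P) (Q? : Decidable Q) → P ≐ Q → count P? ≡ count Q?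
  count-cong P? Q? P≐Q = cong length (filter-≐ P? Q? P≐Q elements)

  count-singleton : ∀ x → count (_≟ x) ≡ 1
  count-singleton x = length-filter-≟ _≟_ elements-unique (elements-complete x)

  module _ {P : Pred A 0ℓ} (P? : Decidable P) where

    count-split : {Q : Pred A 0ℓ} (Q? : Decidable Q) →
      count P? ≡ count (P? ∩? Q?) + count (P? ∩? ∁? Q?)
    count-split Q? = length-filter-split P? Q? elements

    count-∅ : (∀ x → ¬ P x) → count P? ≡ 0
    count-∅ ¬P = cong length (filter-none P? {xs = elements} (All.tabulate (λ {x} _ → ¬P x)))

    count-≡0-or-witness : count P? ≡ 0 ⊎ ∃ P
    count-≡0-or-witness with filter P? elements in eq
    ... | []    = inj₁ refl
    ... | y ∷ _ = inj₂ (y , proj₂ (∈-filter⁻ P? {xs = elements} (subst (y ∈_) (sym eq) (here refl))))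

    count-remove : ∀ {x} → P x → count P? ≡ suc (count (P? ∩? ∁? (_≟ x)))
    count-remove {x} Px = begin
      count P?                                            ≡⟨ count-split (_≟ x) ⟩
      count (P? ∩? (_≟ x)) + count (P? ∩? ∁? (_≟ x))      ≡⟨ cong (_+ count (P? ∩? ∁? (_≟ x))) single ⟩
      suc (count (P? ∩? ∁? (_≟ x)))                       ∎
      where
      single : count (P? ∩? (_≟ x)) ≡ 1
      single = trans (count-cong (P? ∩? (_≟ x)) (_≟ x) (proj₂ , λ { refl → Px , refl })) (count-singleton x)

  count-∁-singleton : ∀ x → suc (count (∁? (_≟ x))) ≡ length elements
  count-∁-singleton x = begin
    suc (count (∁? (_≟ x)))         ≡⟨ cong suc (count-cong _ (U? ∩? ∁? (_≟ x)) ((_ ,_) , proj₂)) ⟩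
    suc (count (U? ∩? ∁? (_≟ x)))   ≡⟨ count-remove U? _ ⟨
    count U?                        ≡⟨ cong length (filter-all U? (All.universal _ elements)) ⟩
    length elements                 ∎

  count-remove-all : ∀ {P : Pred A 0ℓ} (P? : Decidable P) {L} → Unique L → All P L →
    count P? ≡ length L + count (P? ∩? ∁? (_∈? L))
  count-remove-all P? {[]} _ _ = count-cong P? (P? ∩? ∁? (_∈? [])) ((_, λ ()) , proj₁)
  count-remove-all P? {x ∷ L} (x∉L ∷ L-unique) (Px ∷ PL) = begin
    count P?                                       ≡⟨ count-remove P? Px ⟩
    suc (count P∖x?)                               ≡⟨ cong suc (count-remove-all P∖x? L-unique P∖x-L) ⟩
    suc (length L + count (P∖x? ∩? ∁? (_∈? L)))    ≡⟨ cong (suc ∘ (length L +_)) (count-cong _ _ reassoc) ⟩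
    suc (length L + count (P? ∩? ∁? (_∈? x ∷ L)))  ∎
    where
    P∖x? = P? ∩? ∁? (_≟ x)
    P∖x-L = All.zipWith (λ { (Py , x≢y) → Py , λ y≡x → x≢y (sym y≡x) }) (PL , x∉L)
    reassoc = (λ { ((Py , y≢x) , y∉L) → Py , λ { (here y≡x) → y≢x y≡x ; (there y∈L) → y∉L y∈L } })
            , (λ { (Py , y∉xL) → (Py , y∉xL ∘ here) , y∉xL ∘ there })

  record Orbit (σ : A → A) (Q : Pred A 0ℓ) (n : ℕ) : Set where
    field
      points        : List A
      length-points : length points ≡ n
      points-unique : Unique points
      points-in     : All Q points
      rest-closed   : Q ∖ (_∈ points) ⊆ σ ⊢ (Q ∖ (_∈ points))

  count-by-orbits : ∀ {σ n} {P : Pred A 0ℓ} (P? : Decidable P) → P ⊆ σ ⊢ P →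
    (∀ {Q} → Q ⊆ P → Q ⊆ σ ⊢ Q → ∀ {x} → Q x → Orbit σ Q (suc n)) →
    ∃[ k ] count P? ≡ suc n * k
  count-by-orbits {σ} {n} {P} P? P-closed orbit = go (count P?) P? ℕₚ.≤-refl id P-closed
    where
    go : ∀ m {Q} (Q? : Decidable Q) → count Q? ≤ m → Q ⊆ P → Q ⊆ σ ⊢ Q → ∃[ k ] count Q? ≡ suc n * k
    go m Q? bound Q⊆P Q-closed with count-≡0-or-witness Q?
    ... | inj₁ empty = 0 , trans empty (sym (ℕₚ.*-zeroʳ (suc n)))
    go zero Q? bound Q⊆P Q-closed | inj₂ (x , Qx) with () ← subst (_≤ 0) (count-remove Q? Qx) bound
    go (suc m) Q? bound Q⊆P Q-closed | inj₂ (x , Qx) = suc k , (begin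
      count Q?           ≡⟨ split ⟩
      suc n + count R?   ≡⟨ cong (suc n +_) count-R ⟩
      suc n + suc n * k  ≡⟨ ℕₚ.*-suc (suc n) k ⟨
      suc n * suc k      ∎)
      where
      open Orbit (orbit Q⊆P Q-closed Qx)
      R? = Q? ∩? ∁? (_∈? points)
      split : count Q? ≡ suc n + count R?
      split = trans (count-remove-all Q? points-unique points-in) (cong (_+ count R?) length-points)
      smaller : count R? ≤ m
      smaller with s≤s n+c≤m ← subst (_≤ suc m) split bound = ℕₚ.m+n≤o⇒n≤o n n+c≤m
      rest = go m R? smaller (Q⊆P ∘ proj₁) rest-closed
      k = proj₁ rest
      count-R = proj₂ rest

  private
    rest-closed-by : ∀ {σ : A → A} {Q : Pred A 0ℓ} {L} (τ : A → A) →
      (∀ {y} → Q y → τ (σ y) ≡ y) → (∀ {z} → z ∈ L → τ z ∈ L) →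
      Q ⊆ σ ⊢ Q → Q ∖ (_∈ L) ⊆ σ ⊢ (Q ∖ (_∈ L))
    rest-closed-by {L = L} τ τ-inverts τ-stays Q-closed (Qy , y∉L) =
      Q-closed Qy , λ σy∈L → y∉L (subst (_∈ L) (τ-inverts Qy) (τ-stays σy∈L))

  count-mod-orbits : ∀ {σ n} {P : Pred A 0ℓ} (P? : Decidable P) →
    P ∖ Fixed σ ⊆ σ ⊢ (P ∖ Fixed σ) →
    (∀ {Q} → Q ⊆ P ∖ Fixed σ → Q ⊆ σ ⊢ Q → ∀ {x} → Q x → Orbit σ Q (suc n)) →
    ∃[ k ] count P? ≡ count (P? ∩? fixed? σ) + suc n * k
  count-mod-orbits {σ} P? moving-closed orbit =
    Product.map₂ (trans (count-split P? (fixed? σ)) ∘ cong (count (P? ∩? fixed? σ) +_))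
                 (count-by-orbits (P? ∩? ∁? (fixed? σ)) moving-closed orbit)

  count-mod-2 : ∀ {σ} {P : Pred A 0ℓ} (P? : Decidable P) → P ⊆ σ ⊢ P →
    (∀ {x} → P x → σ (σ x) ≡ x) →
    ∃[ k ] count P? ≡ count (P? ∩? fixed? σ) + 2 * k
  count-mod-2 {σ} {P} P? P-closed involutive = count-mod-orbits P? moving-closed orbit
    where
    moving-closed : P ∖ Fixed σ ⊆ σ ⊢ (P ∖ Fixed σ)
    moving-closed (Px , moves) = P-closed Px , λ σx-fixed → moves (trans (sym σx-fixed) (involutive Px))

    orbit : ∀ {Q} → Q ⊆ P ∖ Fixed σ → Q ⊆ σ ⊢ Q → ∀ {x} → Q x → Orbit σ Q 2
    orbit Q⊆ Q-closed {x} Qx = record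
      { points        = x ∷ σ x ∷ []
      ; length-points = refl
      ; points-unique = (x≢σx ∷ []) ∷ [] ∷ []
      ; points-in     = Qx ∷ Q-closed Qx ∷ []
      ; rest-closed   = rest-closed-by σ (involutive ∘ proj₁ ∘ Q⊆) σ-stays Q-closed
      }
      where
      x≢σx : ¬ x ≡ σ x
      x≢σx x≡σx = proj₂ (Q⊆ Qx) (sym x≡σx)
      σ-stays : ∀ {z} → z ∈ x ∷ σ x ∷ [] → σ z ∈ x ∷ σ x ∷ []
      σ-stays (here refl)         = there (here refl)
      σ-stays (there (here refl)) = here (involutive (proj₁ (Q⊆ Qx)))

  count-mod-3 : ∀ {σ} {P : Pred A 0ℓ} (P? : Decidable P) → P ⊆ σ ⊢ P →
    (∀ {x} → P x → σ (σ (σ x)) ≡ x) →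
    ∃[ k ] count P? ≡ count (P? ∩? fixed? σ) + 3 * k
  count-mod-3 {σ} {P} P? P-closed period = count-mod-orbits P? moving-closed orbit
    where
    moving-closed : P ∖ Fixed σ ⊆ σ ⊢ (P ∖ Fixed σ)
    moving-closed (Px , moves) = P-closed Px , λ σx-fixed →
      moves (trans (sym (trans (cong σ σx-fixed) σx-fixed)) (period Px))

    orbit : ∀ {Q} → Q ⊆ P ∖ Fixed σ → Q ⊆ σ ⊢ Q → ∀ {x} → Q x → Orbit σ Q 3
    orbit Q⊆ Q-closed {x} Qx = record
      { points        = x ∷ σ x ∷ σ (σ x) ∷ []
      ; length-points = refl
      ; points-unique = (x≢σx ∷ x≢σσx ∷ []) ∷ (σx≢σσx ∷ []) ∷ [] ∷ []
      ; points-in     = Qx ∷ Q-closed Qx ∷ Q-closed (Q-closed Qx) ∷ []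
      ; rest-closed   = rest-closed-by (σ ∘ σ) (period ∘ proj₁ ∘ Q⊆) σσ-stays Q-closed
      }
      where
      Px = proj₁ (Q⊆ Qx)
      moves = proj₂ (Q⊆ Qx)
      x≢σx : ¬ x ≡ σ x
      x≢σx x≡σx = moves (sym x≡σx)
      x≢σσx : ¬ x ≡ σ (σ x)
      x≢σσx x≡σσx = moves (trans (cong σ x≡σσx) (period Px))
      σx≢σσx : ¬ σ x ≡ σ (σ x)
      σx≢σσx e = x≢σx (trans (sym (period Px)) (trans (cong σ (sym e)) (sym e)))
      σσ-stays : ∀ {z} → z ∈ x ∷ σ x ∷ σ (σ x) ∷ [] → σ (σ z) ∈ x ∷ σ x ∷ σ (σ x) ∷ []
      σσ-stays (here refl)                 = there (there (here refl))
      σσ-stays (there (here refl))         = here (period Px)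
      σσ-stays (there (there (here refl))) = there (here (cong σ (period Px)))

-- Arithmetic modulo m

module Modular (m : ℕ) .{{_ : NonZero m}} where

  open import Data.Nat.DivMod using (_/_; m≡m%n+[m/n]*n; [m+kn]%n≡m%n; m<n⇒m%n≡m)
  open import Data.Integer using (ℤ; +_; -[1+_]; -_; _+_; _*_; _-_; 0ℤ; 1ℤ)
  open import Data.Integer.Properties using (pos-+; pos-*; +-injective)
  open import Data.Integer.DivMod using (_%ℕ_; _/ℕ_; n%ℕd<d; a≡a%ℕn+[a/ℕn]*n)
  open import Data.Integer.Divisibility.Signed
    using (_∣_; divides; _∣?_; ∣m∣n⇒∣m+n; ∣m⇒∣-m; ∣n⇒∣m*n; ∣m⇒∣m*n)
  open import Data.Integer.Tactic.RingSolver using (solve-∀)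
  open import Data.Fin using (fromℕ<)
  open import Data.Fin.Properties using (toℕ<n; toℕ-fromℕ<; toℕ-injective)
  open import Relation.Nullary using (Dec)
  open import Relation.Nullary.Decidable using (map′)
  open import Relation.Binary.Bundles using (Setoid)
  import Relation.Binary.Reasoning.Setoid
  open ≡-Reasoning

  infix 4 _≈_ _≉_ _≈?_

  -- A record rather than a synonym for + m ∣ a - b, so that a and b stay inferable.
  record _≈_ (a b : ℤ) : Set where
    constructor congruent
    field difference-divisible : + m ∣ a - b

  _≉_ : ℤ → ℤ → Set
  a ≉ b = ¬ a ≈ b

  private
    congruent-via : ∀ {a b c} → a - b ≡ c → + m ∣ c → a ≈ b
    congruent-via a-b≡c m∣c = congruent (subst (+ m ∣_) (sym a-b≡c) m∣c)

  _≈?_ : ∀ a b → Dec (a ≈ b)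
  a ≈? b = map′ congruent _≈_.difference-divisible (+ m ∣? (a - b))

  ≈-reflexive : ∀ {a b} → a ≡ b → a ≈ b
  ≈-reflexive {a} refl = congruent (divides 0ℤ (a-a≡0*m a (+ m)))
    where
    a-a≡0*m : ∀ a m → a - a ≡ 0ℤ * m
    a-a≡0*m = solve-∀

  ≈-refl : ∀ {a} → a ≈ a
  ≈-refl = ≈-reflexive refl

  ≈-sym : ∀ {a b} → a ≈ b → b ≈ a
  ≈-sym {a} {b} (congruent m∣a-b) = congruent-via (identity a b) (∣m⇒∣-m m∣a-b)
    where
    identity : ∀ a b → b - a ≡ - (a - b)
    identity = solve-∀

  ≈-trans : ∀ {a b c} → a ≈ b → b ≈ c → a ≈ c
  ≈-trans {a} {b} {c} (congruent m∣a-b) (congruent m∣b-c) =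
    congruent-via (identity a b c) (∣m∣n⇒∣m+n m∣a-b m∣b-c)
    where
    identity : ∀ a b c → a - c ≡ (a - b) + (b - c)
    identity = solve-∀

  +-cong : ∀ {a b c d} → a ≈ b → c ≈ d → a + c ≈ b + d
  +-cong {a} {b} {c} {d} (congruent m∣a-b) (congruent m∣c-d) =
    congruent-via (identity a b c d) (∣m∣n⇒∣m+n m∣a-b m∣c-d)
    where
    identity : ∀ a b c d → (a + c) - (b + d) ≡ (a - b) + (c - d)
    identity = solve-∀

  *-cong : ∀ {a b c d} → a ≈ b → c ≈ d → a * c ≈ b * d
  *-cong {a} {b} {c} {d} (congruent m∣a-b) (congruent m∣c-d) =
    congruent-via (identity a b c d) (∣m∣n⇒∣m+n (∣m⇒∣m*n c m∣a-b) (∣n⇒∣m*n b m∣c-d))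
    where
    identity : ∀ a b c d → a * c - b * d ≡ (a - b) * c + b * (c - d)
    identity = solve-∀

  -‿cong : ∀ {a b} → a ≈ b → - a ≈ - b
  -‿cong {a} {b} (congruent m∣a-b) = congruent-via (identity a b) (∣m⇒∣-m m∣a-b)
    where
    identity : ∀ a b → - a - - b ≡ - (a - b)
    identity = solve-∀

  cube-cong : ∀ {a b} → a ≈ b → a * a * a ≈ b * b * b
  cube-cong a≈b = *-cong (*-cong a≈b a≈b) a≈b

  ≈-setoid : Setoid _ _
  ≈-setoid = record
    { Carrier = ℤ ; _≈_ = _≈_
    ; isEquivalence = record { refl = ≈-refl ; sym = ≈-sym ; trans = ≈-trans } }

  module ≈-Reasoning = Relation.Binary.Reasoning.Setoid ≈-setoid

  private
    nonnegative-quotient : ∀ {k n j} → + k - + n ≡ + j * + m → k % m ≡ n % m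
    nonnegative-quotient {k} {n} {j} k-n≡jm = trans (cong (_% m) k≡n+jm) ([m+kn]%n≡m%n n j m)
      where
      identity : ∀ k n → k ≡ n + (k - n)
      identity = solve-∀
      k≡n+jm : k ≡ n ℕ.+ j ℕ.* m
      k≡n+jm = +-injective (begin
        + k                   ≡⟨ identity (+ k) (+ n) ⟩
        + n + (+ k - + n)     ≡⟨ cong (_+_ (+ n)) k-n≡jm ⟩
        + n + + j * + m       ≡⟨ cong (_+_ (+ n)) (sym (pos-* j m)) ⟩
        + n + + (j ℕ.* m)     ≡⟨ sym (pos-+ n (j ℕ.* m)) ⟩
        + (n ℕ.+ j ℕ.* m)     ∎)

  ℕ-congruent : ∀ k → + k ≈ + (k % m)
  ℕ-congruent k = congruent (divides (+ (k / m)) (begin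
    + k - + (k % m)                         ≡⟨ cong (λ n → + n - + (k % m)) (m≡m%n+[m/n]*n k m) ⟩
    + (k % m ℕ.+ k / m ℕ.* m) - + (k % m)   ≡⟨ cong (_- + (k % m)) (pos-+ (k % m) _) ⟩
    + (k % m) + + (k / m ℕ.* m) - + (k % m) ≡⟨ cong (λ n → + (k % m) + n - + (k % m)) (pos-* (k / m) m) ⟩
    + (k % m) + + (k / m) * + m - + (k % m) ≡⟨ identity (+ (k % m)) (+ (k / m)) (+ m) ⟩
    + (k / m) * + m                         ∎))
    where
    identity : ∀ r q m → r + q * m - r ≡ q * m
    identity = solve-∀

  %≡%⇒≈ : ∀ {k n} → k % m ≡ n % m → + k ≈ + n
  %≡%⇒≈ {k} {n} k%m≡n%m =
    ≈-trans (ℕ-congruent k) (≈-trans (≈-reflexive (cong +_ k%m≡n%m)) (≈-sym (ℕ-congruent n)))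

  ≈⇒%≡% : ∀ {k n} → + k ≈ + n → k % m ≡ n % m
  ≈⇒%≡% (congruent (divides (+ j) k-n≡jm)) = nonnegative-quotient {j = j} k-n≡jm
  ≈⇒%≡% {k} {n} (congruent (divides -[1+ j ] k-n≡-[1+j]m)) =
    sym (nonnegative-quotient {j = suc j} (begin
      + n - + k                 ≡⟨ identity (+ k) (+ n) ⟩
      - (+ k - + n)             ≡⟨ cong -_ k-n≡-[1+j]m ⟩
      - (- + suc j * + m)       ≡⟨ identity₂ (+ suc j) (+ m) ⟩
      + suc j * + m             ∎))
    where
    identity : ∀ k n → n - k ≡ - (k - n)
    identity = solve-∀
    identity₂ : ∀ j m → - (- j * m) ≡ j * m
    identity₂ = solve-∀

  nonzero-residue : ∀ {k} → 0 ℕ.< k → k ℕ.< m → + k ≉ 0ℤ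
  nonzero-residue {k} 0<k k<m k≈0 = ℕₚ.<⇒≢ 0<k (sym (begin
    k       ≡⟨ sym (m<n⇒m%n≡m k<m) ⟩
    k % m   ≡⟨ ≈⇒%≡% k≈0 ⟩
    0 % m   ≡⟨ m<n⇒m%n≡m (ℕ.>-nonZero⁻¹ m) ⟩
    0       ∎))

  -- Residues are listed as Fin m. toℤ is opaque because ℤ multiplication computes on + n:
  -- unfolded, products of residues normalise to sign/magnitude terms and unification blows up.
  opaque
    toℤ : Fin m → ℤ
    toℤ x = + toℕ x

    fromℤ : ℤ → Fin m
    fromℤ a = fromℕ< (n%ℕd<d a m)

    toℤ-fromℤ : ∀ a → toℤ (fromℤ a) ≈ a
    toℤ-fromℤ a = congruent (divides (- (a /ℕ m)) (begin
      toℤ (fromℤ a) - a                       ≡⟨ cong (λ r → + r - a) (toℕ-fromℕ< (n%ℕd<d a m)) ⟩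
      + (a %ℕ m) - a                          ≡⟨ cong (_-_ (+ (a %ℕ m))) (a≡a%ℕn+[a/ℕn]*n a m) ⟩
      + (a %ℕ m) - (+ (a %ℕ m) + a /ℕ m * + m) ≡⟨ identity (+ (a %ℕ m)) (a /ℕ m) (+ m) ⟩
      - (a /ℕ m) * + m                        ∎))
      where
      identity : ∀ r q m → r - (r + q * m) ≡ - q * m
      identity = solve-∀

    toℤ-injective : ∀ {x y} → toℤ x ≈ toℤ y → x ≡ y
    toℤ-injective {x} {y} x≈y = toℕ-injective (begin
      toℕ x       ≡⟨ sym (m<n⇒m%n≡m (toℕ<n x)) ⟩
      toℕ x % m   ≡⟨ ≈⇒%≡% x≈y ⟩
      toℕ y % m   ≡⟨ m<n⇒m%n≡m (toℕ<n y) ⟩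
      toℕ y       ∎)

    toℤ-toℕ : ∀ x → toℤ x ≡ + toℕ x
    toℤ-toℕ x = refl

  fromℤ-≡⇒≈ : ∀ {a x} → fromℤ a ≡ x → a ≈ toℤ x
  fromℤ-≡⇒≈ {a} refl = ≈-sym (toℤ-fromℤ a)

  ≈⇒fromℤ-≡ : ∀ {a x} → a ≈ toℤ x → fromℤ a ≡ x
  ≈⇒fromℤ-≡ {a} a≈x = toℤ-injective (≈-trans (toℤ-fromℤ a) a≈x)

  a-b≈0⇒a≈b : ∀ {a b} → a - b ≈ 0ℤ → a ≈ b
  a-b≈0⇒a≈b {a} {b} (congruent m∣a-b-0) = congruent-via (identity a b) m∣a-b-0
    where
    identity : ∀ a b → a - b ≡ a - b - 0ℤ
    identity = solve-∀

  a≈b⇒a-b≈0 : ∀ {a b} → a ≈ b → a - b ≈ 0ℤ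
  a≈b⇒a-b≈0 {a} {b} (congruent m∣a-b) = congruent-via (identity a b) m∣a-b
    where
    identity : ∀ a b → a - b - 0ℤ ≡ a - b
    identity = solve-∀

-- The prime field

module PrimeField (p : ℕ) .{{_ : NonZero p}} (prime : Prime p) where

  open Modular p public
  open import Data.Nat.DivMod using (_/_; m≡m%n+[m/n]*n; [m+kn]%n≡m%n; m*n%n≡0)
  open import Data.Nat.Primality using (euclidsLemma; prime⇒nonTrivial)
  open import Data.Nat.Divisibility using () renaming (_∣_ to _∣ℕ_)
  open import Data.Nat.Coprimality using (prime⇒coprime; coprime-Bézout)
  open import Data.Nat.GCD using (module Bézout)
  open import Data.Integer using (ℤ; +_; -_; _+_; _*_; _-_; 0ℤ; 1ℤ; ∣_∣)
  open import Data.Integer.Properties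
    using (pos-+; pos-*; abs-*; neg-distribˡ-*; *-identityˡ; *-identityʳ; *-zeroʳ; neg-involutive)
  open import Data.Integer.Divisibility.Signed using (_∣_; divides; ∣⇒∣ᵤ; ∣ᵤ⇒∣)
  open import Data.Integer.Tactic.RingSolver using (solve-∀)
  open import Data.Fin.Properties using (toℕ<n)
  open import Data.List.Membership.Propositional.Properties using (∈-allFin; ∈-cartesianProduct⁺)
  open import Data.List.Relation.Unary.Unique.Propositional.Properties using (allFin⁺; cartesianProduct⁺)
  open import Data.Product.Properties using (≡-dec)
  open import Relation.Nullary.Decidable using (_×-dec_)

  private
    ≈0⇒∣ : ∀ {a} → a ≈ 0ℤ → + p ∣ a
    ≈0⇒∣ {a} (congruent p∣a-0) = subst (+ p ∣_) (identity a) p∣a-0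
      where
      identity : ∀ a → a - 0ℤ ≡ a
      identity = solve-∀

    ∣⇒≈0 : ∀ {a} → + p ∣ a → a ≈ 0ℤ
    ∣⇒≈0 {a} p∣a = congruent (subst (+ p ∣_) (sym (identity a)) p∣a)
      where
      identity : ∀ a → a - 0ℤ ≡ a
      identity = solve-∀

  zero-product : ∀ a b → a * b ≈ 0ℤ → a ≈ 0ℤ ⊎ b ≈ 0ℤ
  zero-product a b ab≈0 = Sum.map (∣⇒≈0 ∘ ∣ᵤ⇒∣) (∣⇒≈0 ∘ ∣ᵤ⇒∣)
    (euclidsLemma ∣ a ∣ ∣ b ∣ prime (subst (p ∣ℕ_) (abs-* a b) (∣⇒∣ᵤ (≈0⇒∣ ab≈0))))

  private
    pos-bézout : ∀ a b c d → 1 ℕ.+ a ℕ.* b ≡ c ℕ.* d → 1ℤ + + a * + b ≡ + c * + d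
    pos-bézout a b c d eq =
      trans (cong (_+_ 1ℤ) (sym (pos-* a b))) (trans (sym (pos-+ 1 (a ℕ.* b))) (trans (cong +_ eq) (pos-* c d)))

    inverse-residue : (k : ℕ) → k ℕ.< p → ℤ
    inverse-residue zero    _   = 0ℤ   -- junk value: 0 has no inverse
    inverse-residue (suc k) k<p with coprime-Bézout (prime⇒coprime prime k<p)
    ... | Bézout.+- _ y _ = - + y
    ... | Bézout.-+ _ y _ = + y

    inverse-residue-correct : ∀ k k<p → + k ≉ 0ℤ → + k * inverse-residue k k<p ≈ 1ℤ
    inverse-residue-correct zero    _   0≉0 = contradiction ≈-refl 0≉0
    inverse-residue-correct (suc k) k<p _ with coprime-Bézout (prime⇒coprime prime k<p)
    ... | Bézout.+- x y 1+yk≡xp = congruent (divides (- + x) (trans (identity (+ suc k) (+ y))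
      (trans (cong -_ (pos-bézout y (suc k) x p 1+yk≡xp)) (neg-distribˡ-* (+ x) (+ p)))))
      where
      identity : ∀ k y → k * - y - 1ℤ ≡ - (1ℤ + y * k)
      identity = solve-∀
    ... | Bézout.-+ x y 1+xp≡yk = congruent (divides (+ x) (trans (identity (+ suc k) (+ y))
      (trans (cong (_- 1ℤ) (sym (pos-bézout x p y (suc k) 1+xp≡yk))) (identity₂ (+ x * + p)))))
      where
      identity : ∀ k y → k * y - 1ℤ ≡ y * k - 1ℤ
      identity = solve-∀
      identity₂ : ∀ a → 1ℤ + a - 1ℤ ≡ a
      identity₂ = solve-∀

  _⁻¹ : Fin p → Fin p
  x ⁻¹ = fromℤ (inverse-residue (toℕ x) (toℕ<n x))

  ⁻¹-inverse : ∀ {x} → toℤ x ≉ 0ℤ → toℤ x * toℤ (x ⁻¹) ≈ 1ℤ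
  ⁻¹-inverse {x} x≉0 = ≈-trans (*-cong (≈-reflexive (toℤ-toℕ x)) (toℤ-fromℤ _))
    (inverse-residue-correct (toℕ x) (toℕ<n x) (subst (_≉ 0ℤ) (toℤ-toℕ x) x≉0))

  ⁻¹-unique : ∀ {x b} → toℤ x ≉ 0ℤ → toℤ x * b ≈ 1ℤ → toℤ (x ⁻¹) ≈ b
  ⁻¹-unique {x} {b} x≉0 xb≈1 = begin
    toℤ (x ⁻¹)                 ≡⟨ *-identityʳ (toℤ (x ⁻¹)) ⟨
    toℤ (x ⁻¹) * 1ℤ            ≈⟨ *-cong (≈-refl {toℤ (x ⁻¹)}) xb≈1 ⟨
    toℤ (x ⁻¹) * (toℤ x * b)   ≡⟨ identity (toℤ (x ⁻¹)) (toℤ x) b ⟩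
    toℤ x * toℤ (x ⁻¹) * b     ≈⟨ *-cong (⁻¹-inverse x≉0) (≈-refl {b}) ⟩
    1ℤ * b                     ≡⟨ *-identityˡ b ⟩
    b                          ∎
    where
    open ≈-Reasoning
    identity : ∀ a x b → a * (x * b) ≡ x * a * b
    identity = solve-∀

  private
    difference-of-squares : ∀ a b → (a - b) * (a + b) ≡ a * a - b * b
    difference-of-squares = solve-∀

    a-[-b]≡a+b : ∀ a b → a - - b ≡ a + b
    a-[-b]≡a+b = solve-∀

    2a≡a-[-a] : ∀ a → + 2 * a ≡ a - - a
    2a≡a-[-a] = solve-∀

  a*a≈b*b⇒a≈±b : ∀ {a b} → a * a ≈ b * b → a ≈ b ⊎ a ≈ - b
  a*a≈b*b⇒a≈±b {a} {b} a²≈b² =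
    Sum.map a-b≈0⇒a≈b (λ a+b≈0 → a-b≈0⇒a≈b (≈-trans (≈-reflexive (a-[-b]≡a+b a b)) a+b≈0))
      (zero-product (a - b) (a + b) (≈-trans (≈-reflexive (difference-of-squares a b)) (a≈b⇒a-b≈0 a²≈b²)))

  a≈-a⇒a≈0 : ∀ {a} → + 2 ≉ 0ℤ → a ≈ - a → a ≈ 0ℤ
  a≈-a⇒a≈0 {a} 2≉0 a≈-a =
    [ ⊥-elim ∘ 2≉0 , id ]′ (zero-product (+ 2) a (≈-trans (≈-reflexive (2a≡a-[-a] a)) (a≈b⇒a-b≈0 a≈-a)))

  module 𝔽 = Counting Fin._≟_ (allFin p) (allFin⁺ p) ∈-allFin

  pairs-complete : ∀ (z : Fin p × Fin p) → z ∈ cartesianProduct (allFin p) (allFin p)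
  pairs-complete (x , y) = ∈-cartesianProduct⁺ (∈-allFin x) (∈-allFin y)

  _≟²_ : DecidableEquality (Fin p × Fin p)
  _≟²_ = ≡-dec Fin._≟_ Fin._≟_

  module 𝔽² = Counting _≟²_ (cartesianProduct (allFin p) (allFin p))
                       (cartesianProduct⁺ (allFin⁺ p) (allFin⁺ p)) pairs-complete

  count-× : ∀ {P Q : Pred (Fin p) 0ℓ} (P? : Decidable P) (Q? : Decidable Q) →
    𝔽².count (P? ×? Q?) ≡ 𝔽.count P? ℕ.* 𝔽.count Q?
  count-× P? Q? = length-filter-cartesianProduct P? Q? (allFin p) (allFin p)

  0F : Fin p
  0F = fromℤ 0ℤ

  ≈0⇒≡0F : ∀ {x} → toℤ x ≈ 0ℤ → x ≡ 0F
  ≈0⇒≡0F x≈0 = sym (≈⇒fromℤ-≡ (≈-sym x≈0))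

  ≡0F⇒≈0 : ∀ {x} → x ≡ 0F → toℤ x ≈ 0ℤ
  ≡0F⇒≈0 refl = toℤ-fromℤ 0ℤ

  SquareRootOf : ℤ → Pred (Fin p) 0ℓ
  SquareRootOf c y = toℤ y * toℤ y ≈ c

  square-root-of? : ∀ c → Decidable (SquareRootOf c)
  square-root-of? c y = toℤ y * toℤ y ≈? c

  count-square-roots : ∀ {c} → + 2 ≉ 0ℤ → c ≉ 0ℤ →
    𝔽.count (square-root-of? c) ≡ 0 ⊎ 𝔽.count (square-root-of? c) ≡ 2
  count-square-roots {c} 2≉0 c≉0 = Sum.map id two-roots (𝔽.count-≡0-or-witness (square-root-of? c))
    where
    open ≡-Reasoning
    two-roots : ∃ (SquareRootOf c) → 𝔽.count (square-root-of? c) ≡ 2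
    two-roots (y₀ , y₀²≈c) = begin
      𝔽.count (square-root-of? c)                           ≡⟨ 𝔽.count-remove _ y₀²≈c ⟩
      suc (𝔽.count (square-root-of? c ∩? ∁? (Fin._≟ y₀)))    ≡⟨ cong suc (𝔽.count-cong _ _ (to-other , from-other)) ⟩
      suc (𝔽.count (Fin._≟ -y₀))                             ≡⟨ cong suc (𝔽.count-singleton -y₀) ⟩
      2                                                     ∎
      where
      -y₀ : Fin p
      -y₀ = fromℤ (- toℤ y₀)

      to-other : SquareRootOf c ∖ (_≡ y₀) ⊆ (_≡ -y₀)
      to-other {y} (y²≈c , y≢y₀) = [ ⊥-elim ∘ y≢y₀ ∘ toℤ-injective , sym ∘ ≈⇒fromℤ-≡ ∘ ≈-sym ]′
        (a*a≈b*b⇒a≈±b (≈-trans y²≈c (≈-sym y₀²≈c)))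

      from-other : (_≡ -y₀) ⊆ SquareRootOf c ∖ (_≡ y₀)
      from-other refl = ≈-trans (≈-trans (*-cong -y₀≈ -y₀≈) (≈-reflexive (identity (toℤ y₀)))) y₀²≈c , -y₀≢y₀
        where
        -y₀≈ = toℤ-fromℤ (- toℤ y₀)
        identity : ∀ a → - a * - a ≡ a * a
        identity = solve-∀
        -y₀≢y₀ : -y₀ ≢ y₀
        -y₀≢y₀ e = c≉0 (≈-trans (≈-sym y₀²≈c) (≈-trans (*-cong y₀≈0 y₀≈0) (≈-reflexive refl)))
          where
          y₀≈0 = a≈-a⇒a≈0 2≉0 (≈-sym (fromℤ-≡⇒≈ e))

  1F : Fin p
  1F = fromℤ 1ℤ

  1≉0 : 1ℤ ≉ 0ℤ
  1≉0 = nonzero-residue (s≤s z≤n) (ℕ.nonTrivial⇒n>1 p {{prime⇒nonTrivial prime}})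

  ≢0F⇒≉0 : ∀ {x} → x ≢ 0F → toℤ x ≉ 0ℤ
  ≢0F⇒≉0 x≢0 x≈0 = x≢0 (≈0⇒≡0F x≈0)

  _·_ : Fin p → Fin p → Fin p
  x · y = fromℤ (toℤ x * toℤ y)

  ·-≉0 : ∀ {x y} → toℤ x ≉ 0ℤ → toℤ y ≉ 0ℤ → toℤ (x · y) ≉ 0ℤ
  ·-≉0 {x} {y} x≉0 y≉0 xy≈0 =
    [ x≉0 , y≉0 ]′ (zero-product (toℤ x) (toℤ y) (≈-trans (≈-sym (toℤ-fromℤ _)) xy≈0))

  ⁻¹-≉0 : ∀ {x} → toℤ x ≉ 0ℤ → toℤ (x ⁻¹) ≉ 0ℤ
  ⁻¹-≉0 {x} x≉0 x⁻¹≈0 = 1≉0 (begin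
    1ℤ                   ≈⟨ ⁻¹-inverse x≉0 ⟨
    toℤ x * toℤ (x ⁻¹)   ≈⟨ *-cong (≈-refl {toℤ x}) x⁻¹≈0 ⟩
    toℤ x * 0ℤ           ≡⟨ *-zeroʳ (toℤ x) ⟩
    0ℤ                   ∎)
    where open ≈-Reasoning

  Units : Pred (Fin p × Fin p) 0ℓ
  Units = ∁ (_≡ 0F) ⟨×⟩ ∁ (_≡ 0F)

  units? : Decidable Units
  units? = ∁? (Fin._≟ 0F) ×? ∁? (Fin._≟ 0F)

  -- The cyclic shift (u, v, w) ↦ (v, w, u) on the triples with u v w = 1, w eliminated.
  rotate : Fin p × Fin p → Fin p × Fin p
  rotate (u , v) = v , (u · v) ⁻¹

  rotate-closed : Units ⊆ rotate ⊢ Units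
  rotate-closed (u≢0 , v≢0) = v≢0 , ⁻¹-≉0 (·-≉0 (≢0F⇒≉0 u≢0) (≢0F⇒≉0 v≢0)) ∘ ≡0F⇒≈0

  ·⁻¹-unique : ∀ {x y z} → toℤ x ≉ 0ℤ → toℤ y ≉ 0ℤ →
    toℤ x * toℤ y * toℤ z ≈ 1ℤ → (x · y) ⁻¹ ≡ z
  ·⁻¹-unique {x} {y} {z} x≉0 y≉0 xyz≈1 =
    toℤ-injective (⁻¹-unique (·-≉0 x≉0 y≉0) (≈-trans (*-cong (toℤ-fromℤ _) (≈-refl {toℤ z})) xyz≈1))

  rotate-period : ∀ {z} → Units z → rotate (rotate (rotate z)) ≡ z
  rotate-period {u , v} (u≢0 , v≢0) =
    cong₂ _,_ vw⁻¹≡u (trans (cong (λ t → (w · t) ⁻¹) vw⁻¹≡u) wu⁻¹≡v)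
    where
    w = (u · v) ⁻¹
    u≉0 = ≢0F⇒≉0 u≢0
    v≉0 = ≢0F⇒≉0 v≢0
    w≉0 = ⁻¹-≉0 (·-≉0 u≉0 v≉0)
    uvw≈1 : toℤ u * toℤ v * toℤ w ≈ 1ℤ
    uvw≈1 = ≈-trans (*-cong (≈-sym (toℤ-fromℤ _)) (≈-refl {toℤ w})) (⁻¹-inverse (·-≉0 u≉0 v≉0))
    vwu≡uvw : ∀ u v w → v * w * u ≡ u * v * w
    vwu≡uvw = solve-∀
    wuv≡uvw : ∀ u v w → w * u * v ≡ u * v * w
    wuv≡uvw = solve-∀
    vw⁻¹≡u : (v · w) ⁻¹ ≡ u
    vw⁻¹≡u = ·⁻¹-unique v≉0 w≉0 (≈-trans (≈-reflexive (vwu≡uvw (toℤ u) (toℤ v) (toℤ w))) uvw≈1)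
    wu⁻¹≡v : (w · u) ⁻¹ ≡ v
    wu⁻¹≡v = ·⁻¹-unique w≉0 u≉0 (≈-trans (≈-reflexive (wuv≡uvw (toℤ u) (toℤ v) (toℤ w))) uvw≈1)

  rotate-fixed : ∀ {u v} → Units (u , v) → rotate (u , v) ≡ (u , v) → v ≡ u × toℤ u * toℤ u * toℤ u ≈ 1ℤ
  rotate-fixed {u} {v} (u≢0 , _) fixed with refl ← cong proj₁ fixed = refl , (begin
    toℤ u * toℤ u * toℤ u              ≈⟨ *-cong (toℤ-fromℤ _) (≈-reflexive (cong (toℤ ∘ proj₂) fixed)) ⟨
    toℤ (u · u) * toℤ ((u · u) ⁻¹)     ≈⟨ ⁻¹-inverse (·-≉0 (≢0F⇒≉0 u≢0) (≢0F⇒≉0 u≢0)) ⟩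
    1ℤ                                 ∎)
    where open ≈-Reasoning

  -- A nontrivial cube root of unity

  private
    suc-3k≢3m : ∀ k m → suc (3 ℕ.* k) ≢ 3 ℕ.* m
    suc-3k≢3m k m eq = contradiction (begin
      1                     ≡⟨ [m+kn]%n≡m%n 1 k 3 ⟨
      (1 ℕ.+ k ℕ.* 3) % 3   ≡⟨ cong (λ n → suc n % 3) (ℕₚ.*-comm k 3) ⟩
      suc (3 ℕ.* k) % 3     ≡⟨ cong (_% 3) (trans eq (ℕₚ.*-comm 3 m)) ⟩
      (m ℕ.* 3) % 3         ≡⟨ m*n%n≡0 m 3 ⟩
      0                     ∎) λ ()
      where open ≡-Reasoning

  count-units : p % 3 ≡ 1 → ∃[ m ] 𝔽².count units? ≡ 3 ℕ.* m
  count-units p%3≡1 = q ℕ.* c , (begin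
    𝔽².count units?   ≡⟨ count-× _ _ ⟩
    c ℕ.* c           ≡⟨ cong (ℕ._* c) c≡3q ⟩
    3 ℕ.* q ℕ.* c     ≡⟨ ℕₚ.*-assoc 3 q c ⟩
    3 ℕ.* (q ℕ.* c)   ∎)
    where
    open ≡-Reasoning
    c = 𝔽.count (∁? (Fin._≟ 0F))
    q = p / 3
    c≡3q : c ≡ 3 ℕ.* q
    c≡3q = ℕₚ.suc-injective (begin
      suc c                   ≡⟨ 𝔽.count-∁-singleton 0F ⟩
      length (allFin p)       ≡⟨ length-tabulate id ⟩
      p                       ≡⟨ m≡m%n+[m/n]*n p 3 ⟩
      p % 3 ℕ.+ q ℕ.* 3       ≡⟨ cong₂ ℕ._+_ p%3≡1 (ℕₚ.*-comm q 3) ⟩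
      suc (3 ℕ.* q)           ∎)

  cube-root-of-unity : p % 3 ≡ 1 → ∃[ ω ] toℤ ω * toℤ ω * toℤ ω ≈ 1ℤ × toℤ ω ≉ 1ℤ
  cube-root-of-unity p%3≡1 =
    [ ⊥-elim ∘ only-fixed-point-impossible , nontrivial-cube-root ]′ (𝔽².count-≡0-or-witness nontrivial?)
    where
    open ≡-Reasoning
    fixed-units? = units? ∩? 𝔽².fixed? rotate
    1≈1 = toℤ-fromℤ 1ℤ
    1F≢0F : 1F ≢ 0F
    1F≢0F 1≡0 = 1≉0 (≈-trans (≈-sym 1≈1) (≡0F⇒≈0 1≡0))
    1-fixed : (Units ∩ 𝔽².Fixed rotate) (1F , 1F)
    1≉0′ = ≢0F⇒≉0 1F≢0F
    1-fixed = (1F≢0F , 1F≢0F) , cong (1F ,_) (·⁻¹-unique 1≉0′ 1≉0′ (*-cong (*-cong 1≈1 1≈1) 1≈1))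

    nontrivial? = fixed-units? ∩? ∁? (_≟² (1F , 1F))

    only-fixed-point-impossible : 𝔽².count nontrivial? ≢ 0
    only-fixed-point-impossible none = suc-3k≢3m k m (begin
      suc (3 ℕ.* k)                         ≡⟨ cong (ℕ._+ 3 ℕ.* k) one-fixed-point ⟨
      𝔽².count fixed-units? ℕ.+ 3 ℕ.* k     ≡⟨ proj₂ (𝔽².count-mod-3 units? rotate-closed rotate-period) ⟨
      𝔽².count units?                       ≡⟨ proj₂ (count-units p%3≡1) ⟩
      3 ℕ.* m                               ∎)
      where
      k = proj₁ (𝔽².count-mod-3 units? rotate-closed rotate-period)
      m = proj₁ (count-units p%3≡1)
      one-fixed-point = trans (𝔽².count-remove fixed-units? 1-fixed) (cong suc none)

    nontrivial-cube-root : ∃ (Units ∩ 𝔽².Fixed rotate ∖ (_≡ (1F , 1F))) →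
      ∃[ ω ] toℤ ω * toℤ ω * toℤ ω ≈ 1ℤ × toℤ ω ≉ 1ℤ
    nontrivial-cube-root ((u , v) , ((units , fixed) , ≢1)) with refl , u³≈1 ← rotate-fixed units fixed =
      u , u³≈1 , λ u≈1 → ≢1 (cong₂ _,_ (≈1⇒≡1F u≈1) (≈1⇒≡1F u≈1))
      where
      ≈1⇒≡1F : toℤ u ≈ 1ℤ → u ≡ 1F
      ≈1⇒≡1F u≈1 = sym (≈⇒fromℤ-≡ (≈-sym u≈1))

  -- The curve y² = x³ + α³

  E : ℤ → Pred (Fin p × Fin p) 0ℓ
  E α (x , y) = toℤ y * toℤ y ≈ toℤ x * toℤ x * toℤ x + α * α * α

  E? : ∀ α → Decidable (E α)
  E? α (x , y) = toℤ y * toℤ y ≈? toℤ x * toℤ x * toℤ x + α * α * α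

  OnCurve≐E : ∀ a → OnCurve p a ≐ E (+ a)
  OnCurve≐E a =
      (λ {(x , y)} on → ≈-trans (≈-reflexive (square y)) (≈-trans (%≡%⇒≈ on) (≈-reflexive (sym (cube-sum x)))))
    , (λ {(x , y)} on-E → ≈⇒%≡% (≈-trans (≈-reflexive (sym (square y))) (≈-trans on-E (≈-reflexive (cube-sum x)))))
    where
    pos-^ : ∀ n k → + (n ℕ.^ suc k) ≡ + n * + (n ℕ.^ k)
    pos-^ n k = pos-* n (n ℕ.^ k)
    identity₂ : ∀ x → x * (x * + 1) ≡ x * x
    identity₂ = solve-∀
    identity₃ : ∀ x → x * (x * (x * + 1)) ≡ x * x * x
    identity₃ = solve-∀
    square : ∀ y → toℤ y * toℤ y ≡ + (toℕ y ℕ.^ 2)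
    square y = begin
      toℤ y * toℤ y                   ≡⟨ cong₂ _*_ (toℤ-toℕ y) (toℤ-toℕ y) ⟩
      + toℕ y * + toℕ y               ≡⟨ identity₂ (+ toℕ y) ⟨
      + toℕ y * (+ toℕ y * + 1)       ≡⟨ trans (pos-^ (toℕ y) 1) (cong (_*_ (+ toℕ y)) (pos-^ (toℕ y) 0)) ⟨
      + (toℕ y ℕ.^ 2)                 ∎
      where open ≡-Reasoning
    pos-cube : ∀ n → + n * + n * + n ≡ + (n ℕ.^ 3)
    pos-cube n = trans (sym (identity₃ (+ n)))
      (sym (trans (pos-^ n 2) (cong (_*_ (+ n)) (trans (pos-^ n 1) (cong (_*_ (+ n)) (pos-^ n 0))))))
    cube-sum : ∀ x → toℤ x * toℤ x * toℤ x + + a * + a * + a ≡ + (toℕ x ℕ.^ 3 ℕ.+ a ℕ.^ 3)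
    cube-sum x = trans (cong₂ _+_ (trans (cong (λ z → z * z * z) (toℤ-toℕ x)) (pos-cube (toℕ x))) (pos-cube a))
                       (sym (pos-+ (toℕ x ℕ.^ 3) (a ℕ.^ 3)))

  module Curve (3<p : 3 ℕ.< p) (α : ℤ) (α≉0 : α ≉ 0ℤ) where

    2≉0 : + 2 ≉ 0ℤ
    2≉0 = nonzero-residue (s≤s z≤n) (ℕₚ.<-trans (s≤s (s≤s (s≤s z≤n))) 3<p)

    α²≉0 : α * α ≉ 0ℤ
    α²≉0 = [ α≉0 , α≉0 ]′ ∘ zero-product α α

    α³≉0 : α * α * α ≉ 0ℤ
    α³≉0 = [ α²≉0 , α≉0 ]′ ∘ zero-product (α * α) α

    3α²≉0 : + 3 * (α * α) ≉ 0ℤ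
    3α²≉0 = [ nonzero-residue (s≤s z≤n) 3<p , α²≉0 ]′ ∘ zero-product (+ 3) (α * α)

    negate-y : Fin p × Fin p → Fin p × Fin p
    negate-y (x , y) = x , fromℤ (- toℤ y)

    negate-y-closed : E α ⊆ negate-y ⊢ E α
    negate-y-closed {x , y} on-E = begin
      toℤ (fromℤ (- toℤ y)) * toℤ (fromℤ (- toℤ y))  ≈⟨ *-cong (toℤ-fromℤ _) (toℤ-fromℤ _) ⟩
      - toℤ y * - toℤ y                              ≡⟨ identity (toℤ y) ⟩
      toℤ y * toℤ y                                  ≈⟨ on-E ⟩
      toℤ x * toℤ x * toℤ x + α * α * α              ∎
      where
      open ≈-Reasoning
      identity : ∀ a → - a * - a ≡ a * a
      identity = solve-∀

    negate-y-involutive : ∀ {z} → negate-y (negate-y z) ≡ z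
    negate-y-involutive {x , y} =
      cong (x ,_) (≈⇒fromℤ-≡ (≈-trans (-‿cong (toℤ-fromℤ _)) (≈-reflexive (neg-involutive (toℤ y)))))

    negate-y-fixed⇒y≡0 : ∀ {x y} → negate-y (x , y) ≡ (x , y) → y ≡ 0F
    negate-y-fixed⇒y≡0 fixed = ≈0⇒≡0F (a≈-a⇒a≈0 2≉0 (≈-sym (fromℤ-≡⇒≈ (cong proj₂ fixed))))

    y≡0⇒negate-y-fixed : ∀ {x} → negate-y (x , 0F) ≡ (x , 0F)
    y≡0⇒negate-y-fixed {x} =
      cong (x ,_) (≈⇒fromℤ-≡ (≈-trans (-‿cong (toℤ-fromℤ 0ℤ)) (≈-sym (toℤ-fromℤ 0ℤ))))

    q : ℤ → ℤ
    q x = x * x - α * x + α * α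

    q-cong : ∀ {a b} → a ≈ b → q a ≈ q b
    q-cong a≈b = +-cong (+-cong (*-cong a≈b a≈b) (-‿cong (*-cong (≈-refl {α}) a≈b))) (≈-refl {α * α})

    sum-of-cubes : ∀ x → x * x * x + α * α * α ≡ (x + α) * q x
    sum-of-cubes x = identity x α
      where
      identity : ∀ x a → x * x * x + a * a * a ≡ (x + a) * (x * x - a * x + a * a)
      identity = solve-∀

    q[-α]≉0 : q (- α) ≉ 0ℤ
    q[-α]≉0 q[-α]≈0 = 3α²≉0 (≈-trans (≈-reflexive (identity α)) q[-α]≈0)
      where
      identity : ∀ a → + 3 * (a * a) ≡ - a * - a - a * - a + a * a
      identity = solve-∀

    Roots : Pred (Fin p × Fin p) 0ℓ
    Roots (x , y) = y ≡ 0F × q (toℤ x) ≈ 0ℤ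

    roots? : Decidable Roots
    roots? (x , y) = (y Fin.≟ 0F) ×-dec (q (toℤ x) ≈? 0ℤ)

    count-2-torsion : 𝔽².count (E? α ∩? 𝔽².fixed? negate-y) ≡ suc (𝔽².count roots?)
    count-2-torsion = trans (𝔽².count-remove _ (on-E , y≡0⇒negate-y-fixed))
                            (cong suc (𝔽².count-cong _ _ (is-root , is-2-torsion)))
      where
      -α : Fin p
      -α = fromℤ (- α)

      on-E : E α (-α , 0F)
      on-E = begin
        toℤ 0F * toℤ 0F                        ≈⟨ *-cong (toℤ-fromℤ 0ℤ) (toℤ-fromℤ 0ℤ) ⟩
        0ℤ                                     ≡⟨ identity α ⟩
        - α * - α * - α + α * α * α            ≈⟨ +-cong (cube-cong (toℤ-fromℤ (- α))) (≈-refl {α * α * α}) ⟨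
        toℤ -α * toℤ -α * toℤ -α + α * α * α   ∎
        where
        open ≈-Reasoning
        identity : ∀ a → 0ℤ ≡ - a * - a * - a + a * a * a
        identity = solve-∀

      is-root : (E α ∩ 𝔽².Fixed negate-y) ∖ (_≡ (-α , 0F)) ⊆ Roots
      is-root {x , y} ((on-E , fixed) , ≢-α) =
        y≡0 , [ ⊥-elim ∘ x+α≉0 , id ]′ (zero-product (toℤ x + α) (q (toℤ x)) product≈0)
        where
        open ≈-Reasoning
        y≡0 = negate-y-fixed⇒y≡0 fixed
        y≈0 = ≡0F⇒≈0 y≡0
        product≈0 : (toℤ x + α) * q (toℤ x) ≈ 0ℤ
        product≈0 = begin
          (toℤ x + α) * q (toℤ x)                ≡⟨ sum-of-cubes (toℤ x) ⟨
          toℤ x * toℤ x * toℤ x + α * α * α      ≈⟨ on-E ⟨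
          toℤ y * toℤ y                          ≈⟨ *-cong y≈0 y≈0 ⟩
          0ℤ                                     ∎
        x+α≉0 : toℤ x + α ≉ 0ℤ
        x+α≉0 x+α≈0 = ≢-α (cong₂ _,_ (sym (≈⇒fromℤ-≡ (≈-sym x≈-α))) y≡0)
          where
          x≈-α : toℤ x ≈ - α
          x≈-α = a-b≈0⇒a≈b (≈-trans (≈-reflexive (cong (_+_ (toℤ x)) (neg-involutive α))) x+α≈0)

      is-2-torsion : Roots ⊆ (E α ∩ 𝔽².Fixed negate-y) ∖ (_≡ (-α , 0F))
      is-2-torsion {x , y} (refl , qx≈0) = (on-E′ , y≡0⇒negate-y-fixed) , λ x,0≡-α,0 →
        q[-α]≉0 (≈-trans (q-cong (fromℤ-≡⇒≈ (sym (cong proj₁ x,0≡-α,0)))) qx≈0)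
        where
        on-E′ : E α (x , 0F)
        on-E′ = begin
          toℤ 0F * toℤ 0F                        ≈⟨ *-cong (toℤ-fromℤ 0ℤ) (toℤ-fromℤ 0ℤ) ⟩
          0ℤ                                     ≡⟨ *-zeroʳ (toℤ x + α) ⟨
          (toℤ x + α) * 0ℤ                       ≈⟨ *-cong (≈-refl {toℤ x + α}) qx≈0 ⟨
          (toℤ x + α) * q (toℤ x)                ≡⟨ sum-of-cubes (toℤ x) ⟨
          toℤ x * toℤ x * toℤ x + α * α * α      ∎
          where open ≈-Reasoning

    reflect-x : Fin p × Fin p → Fin p × Fin p
    reflect-x (x , y) = fromℤ (α - toℤ x) , y

    reflect-x-closed : Roots ⊆ reflect-x ⊢ Roots
    reflect-x-closed {x , y} (y≡0 , qx≈0) =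
      y≡0 , ≈-trans (q-cong (toℤ-fromℤ _)) (≈-trans (≈-reflexive (identity α (toℤ x))) qx≈0)
      where
      identity : ∀ a x → (a - x) * (a - x) - a * (a - x) + a * a ≡ x * x - a * x + a * a
      identity = solve-∀

    reflect-x-involutive : ∀ {z} → reflect-x (reflect-x z) ≡ z
    reflect-x-involutive {x , y} = cong (_, y) (≈⇒fromℤ-≡
      (≈-trans (+-cong (≈-refl {α}) (-‿cong (toℤ-fromℤ _))) (≈-reflexive (identity α (toℤ x)))))
      where
      identity : ∀ a x → a - (a - x) ≡ x
      identity = solve-∀

    reflect-x-no-fixed : ∀ {z} → Roots z → reflect-x z ≢ z
    reflect-x-no-fixed {x , y} (_ , qx≈0) fixed = 3α²≉0 (begin
      + 3 * (α * α)                      ≡⟨ identity α (toℤ x) ⟩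
      + 4 * q (toℤ x) - d * d            ≈⟨ +-cong (*-cong (≈-refl {+ 4}) qx≈0) (-‿cong (*-cong d≈0 d≈0)) ⟩
      0ℤ                                 ∎)
      where
      open ≈-Reasoning
      d = α - toℤ x - toℤ x
      d≈0 : d ≈ 0ℤ
      d≈0 = a≈b⇒a-b≈0 (fromℤ-≡⇒≈ (cong proj₁ fixed))
      identity : ∀ a x → + 3 * (a * a) ≡ + 4 * (x * x - a * x + a * a) - (a - x - x) * (a - x - x)
      identity = solve-∀

    count-roots-even : ∃[ k ] 𝔽².count roots? ≡ 2 ℕ.* k
    count-roots-even = Product.map₂ (λ count≡ → trans count≡ (cong (ℕ._+ _) no-fixed-roots))
                                    (𝔽².count-mod-2 roots? reflect-x-closed (λ _ → reflect-x-involutive))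
      where
      no-fixed-roots : 𝔽².count (roots? ∩? 𝔽².fixed? reflect-x) ≡ 0
      no-fixed-roots = 𝔽².count-∅ _ λ _ (root , fixed) → reflect-x-no-fixed root fixed

    count-E-odd : ∃[ k ] 𝔽².count (E? α) ≡ suc (2 ℕ.* k)
    count-E-odd = j ℕ.+ k , (begin
      𝔽².count (E? α)                                    ≡⟨ E≡ ⟩
      𝔽².count (E? α ∩? 𝔽².fixed? negate-y) ℕ.+ 2 ℕ.* k  ≡⟨ cong (ℕ._+ 2 ℕ.* k) count-2-torsion ⟩
      suc (𝔽².count roots?) ℕ.+ 2 ℕ.* k                  ≡⟨ cong (λ r → suc r ℕ.+ 2 ℕ.* k) roots≡ ⟩
      suc (2 ℕ.* j ℕ.+ 2 ℕ.* k)                          ≡⟨ cong suc (ℕₚ.*-distribˡ-+ 2 j k) ⟨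
      suc (2 ℕ.* (j ℕ.+ k))                              ∎)
      where
      open ≡-Reasoning
      mod-2 = 𝔽².count-mod-2 (E? α) negate-y-closed (λ _ → negate-y-involutive)
      k = proj₁ mod-2
      E≡ = proj₂ mod-2
      j = proj₁ count-roots-even
      roots≡ = proj₂ count-roots-even

    module _ {ω : Fin p} (ω³≈1 : toℤ ω * toℤ ω * toℤ ω ≈ 1ℤ) (ω≉1 : toℤ ω ≉ 1ℤ) where

      scale-x : Fin p × Fin p → Fin p × Fin p
      scale-x (x , y) = fromℤ (toℤ ω * toℤ x) , y

      private
        ω³a≈a : ∀ a → toℤ ω * toℤ ω * toℤ ω * a ≈ a
        ω³a≈a a = ≈-trans (*-cong ω³≈1 (≈-refl {a})) (≈-reflexive (*-identityˡ a))

      scale-x-closed : E α ⊆ scale-x ⊢ E α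
      scale-x-closed {x , y} on-E = ≈-trans on-E (+-cong (begin
        toℤ x * toℤ x * toℤ x                             ≈⟨ ω³a≈a _ ⟨
        toℤ ω * toℤ ω * toℤ ω * (toℤ x * toℤ x * toℤ x)   ≡⟨ identity (toℤ ω) (toℤ x) ⟩
        ωx * ωx * ωx                                      ≈⟨ cube-cong (toℤ-fromℤ ωx) ⟨
        toℤ (fromℤ ωx) * toℤ (fromℤ ωx) * toℤ (fromℤ ωx)  ∎) (≈-refl {α * α * α}))
        where
        open ≈-Reasoning
        ωx = toℤ ω * toℤ x
        identity : ∀ w x → w * w * w * (x * x * x) ≡ w * x * (w * x) * (w * x)
        identity = solve-∀

      scale-x-period : ∀ {z} → E α z → scale-x (scale-x (scale-x z)) ≡ z
      scale-x-period {x , y} _ = cong (_, y) (≈⇒fromℤ-≡ (begin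
        toℤ ω * toℤ (fromℤ (toℤ ω * toℤ (fromℤ (toℤ ω * toℤ x))))
          ≈⟨ *-cong (≈-refl {toℤ ω}) (≈-trans (toℤ-fromℤ _) (*-cong (≈-refl {toℤ ω}) (toℤ-fromℤ _))) ⟩
        toℤ ω * (toℤ ω * (toℤ ω * toℤ x))   ≡⟨ identity (toℤ ω) (toℤ x) ⟩
        toℤ ω * toℤ ω * toℤ ω * toℤ x       ≈⟨ ω³a≈a (toℤ x) ⟩
        toℤ x                               ∎))
        where
        open ≈-Reasoning
        identity : ∀ w x → w * (w * (w * x)) ≡ w * w * w * x
        identity = solve-∀

      scale-x-fixed⇒x≡0 : ∀ {x y} → scale-x (x , y) ≡ (x , y) → x ≡ 0F
      scale-x-fixed⇒x≡0 {x} fixed =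
        [ ⊥-elim ∘ ω≉1 ∘ a-b≈0⇒a≈b , ≈0⇒≡0F ]′ (zero-product (toℤ ω - 1ℤ) (toℤ x)
          (≈-trans (≈-reflexive (identity (toℤ ω) (toℤ x))) (a≈b⇒a-b≈0 (fromℤ-≡⇒≈ (cong proj₁ fixed)))))
        where
        identity : ∀ w x → (w - 1ℤ) * x ≡ w * x - x
        identity = solve-∀

      x≡0⇒scale-x-fixed : ∀ {y} → scale-x (0F , y) ≡ (0F , y)
      x≡0⇒scale-x-fixed {y} = cong (_, y) (≈⇒fromℤ-≡ (begin
        toℤ ω * toℤ 0F   ≈⟨ *-cong (≈-refl {toℤ ω}) (toℤ-fromℤ 0ℤ) ⟩
        toℤ ω * 0ℤ       ≡⟨ *-zeroʳ (toℤ ω) ⟩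
        0ℤ               ≈⟨ toℤ-fromℤ 0ℤ ⟨
        toℤ 0F           ∎))
        where open ≈-Reasoning

      E-fixed≐ : E α ∩ 𝔽².Fixed scale-x ≐ ((_≡ 0F) ⟨×⟩ SquareRootOf (α * α * α))
      E-fixed≐ = to , from
        where
        0³+α³≈α³ : toℤ 0F * toℤ 0F * toℤ 0F + α * α * α ≈ α * α * α
        0³+α³≈α³ = ≈-trans (+-cong (cube-cong (toℤ-fromℤ 0ℤ)) (≈-refl {α * α * α})) (≈-reflexive (0³+a≡a (α * α * α)))
          where
          0³+a≡a : ∀ a → 0ℤ * 0ℤ * 0ℤ + a ≡ a
          0³+a≡a = solve-∀
        to : E α ∩ 𝔽².Fixed scale-x ⊆ ((_≡ 0F) ⟨×⟩ SquareRootOf (α * α * α))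
        to {x , y} (on-E , fixed) = x≡0 , ≈-trans on-E (at-0 x≡0)
          where
          x≡0 = scale-x-fixed⇒x≡0 fixed
          at-0 : x ≡ 0F → toℤ x * toℤ x * toℤ x + α * α * α ≈ α * α * α
          at-0 refl = 0³+α³≈α³
        from : ((_≡ 0F) ⟨×⟩ SquareRootOf (α * α * α)) ⊆ E α ∩ 𝔽².Fixed scale-x
        from {x , y} (refl , y²≈α³) = ≈-trans y²≈α³ (≈-sym 0³+α³≈α³) , x≡0⇒scale-x-fixed

      count-E-mod-3 : ∃[ f ] ∃[ k ] 𝔽².count (E? α) ≡ f ℕ.+ 3 ℕ.* k × (f ≡ 0 ⊎ f ≡ 2)
      count-E-mod-3 = _ , proj₁ mod-3 , proj₂ mod-3 ,
        Sum.map (trans fixed-count) (trans fixed-count) (count-square-roots 2≉0 α³≉0)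
        where
        open ≡-Reasoning
        mod-3 = 𝔽².count-mod-3 (E? α) scale-x-closed scale-x-period
        √α³? = square-root-of? (α * α * α)
        fixed-count : 𝔽².count (E? α ∩? 𝔽².fixed? scale-x) ≡ 𝔽.count √α³?
        fixed-count = begin
          𝔽².count (E? α ∩? 𝔽².fixed? scale-x)               ≡⟨ 𝔽².count-cong _ _ E-fixed≐ ⟩
          𝔽².count ((Fin._≟ 0F) ×? √α³?)                     ≡⟨ count-× _ _ ⟩
          𝔽.count (Fin._≟ 0F) ℕ.* 𝔽.count √α³?              ≡⟨ cong (ℕ._* 𝔽.count √α³?) (𝔽.count-singleton 0F) ⟩
          1 ℕ.* 𝔽.count √α³?                                ≡⟨ ℕₚ.*-identityˡ _ ⟩
          𝔽.count √α³?                                      ∎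

module _ where

  open import Data.Nat using (_+_; _*_)
  open import Data.Nat.DivMod using (_/_; m≡m%n+[m/n]*n; m∣n⇒o%n%m≡o%m; [m+kn]%n≡m%n; m*n%n≡0; m%n<n)
  open import Data.Nat.Divisibility using (divides)
  open import Data.Nat.Primality using (prime⇒nonTrivial)
  import Data.Nat.Tactic.RingSolver as ℕ-Solver

  p≡1[6]⇒3<p : ∀ {p} .{{_ : NonZero p}} → Prime p → p % 6 ≡ 1 → 3 < p
  p≡1[6]⇒3<p {p} p-prime p%6≡1 with p / 6 | m≡m%n+[m/n]*n p 6
  ... | zero  | p≡p%6 = contradiction (subst (1 <_) (trans p≡p%6 (cong (_+ 0) p%6≡1))
                                       (ℕ.nonTrivial⇒n>1 p {{prime⇒nonTrivial p-prime}})) (ℕₚ.<-irrefl refl)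
  ... | suc q | p≡    = subst (3 <_) (sym (trans p≡ (cong (_+ suc q * 6) p%6≡1))) (s≤s (s≤s (s≤s (s≤s z≤n))))

  p≡1[6]⇒p≡1[3] : ∀ p → p % 6 ≡ 1 → p % 3 ≡ 1
  p≡1[6]⇒p≡1[3] p p%6≡1 = trans (sym (m∣n⇒o%n%m≡o%m 3 6 p (divides 2 refl))) (cong (_% 3) p%6≡1)

  private
    even-residue-mod-6 : ∀ r → r < 6 → r % 2 ≡ 0 → r % 3 ≡ 1 ⊎ r % 3 ≡ 0 → r ≡ 0 ⊎ r ≡ 4
    even-residue-mod-6 0 _ _ _ = inj₁ refl
    even-residue-mod-6 1 _ () _
    even-residue-mod-6 2 _ _ (inj₁ ())
    even-residue-mod-6 2 _ _ (inj₂ ())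
    even-residue-mod-6 3 _ () _
    even-residue-mod-6 4 _ _ _ = inj₂ refl
    even-residue-mod-6 5 _ () _
    even-residue-mod-6 (suc (suc (suc (suc (suc (suc _)))))) (s≤s (s≤s (s≤s (s≤s (s≤s (s≤s ())))))) _ _

  suc-mod-6 : ∀ {n} j f k → n ≡ suc (2 * j) → n ≡ f + 3 * k → f ≡ 0 ⊎ f ≡ 2 →
    suc n % 6 ≡ 0 ⊎ suc n % 6 ≡ 4
  suc-mod-6 {n} j f k n≡1+2j n≡f+3k f≡0∨2 = even-residue-mod-6 (suc n % 6) (m%n<n (suc n) 6) even mod-3
    where
    2+2j≡[1+j]2 : ∀ j → suc (suc (2 * j)) ≡ suc j * 2
    2+2j≡[1+j]2 = ℕ-Solver.solve-∀
    1+f+3k≡1+f+k3 : ∀ f k → suc (f + 3 * k) ≡ suc f + k * 3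
    1+f+3k≡1+f+k3 = ℕ-Solver.solve-∀
    even : suc n % 6 % 2 ≡ 0
    even = trans (m∣n⇒o%n%m≡o%m 2 6 (suc n) (divides 3 refl))
      (trans (cong (_% 2) (trans (cong suc n≡1+2j) (2+2j≡[1+j]2 j))) (m*n%n≡0 (suc j) 2))
    residue : suc n % 6 % 3 ≡ suc f % 3
    residue = trans (m∣n⇒o%n%m≡o%m 3 6 (suc n) (divides 2 refl))
      (trans (cong (_% 3) (trans (cong suc n≡f+3k) (1+f+3k≡1+f+k3 f k))) ([m+kn]%n≡m%n (suc f) k 3))
    mod-3 : suc n % 6 % 3 ≡ 1 ⊎ suc n % 6 % 3 ≡ 0
    mod-3 = Sum.map (λ f≡0 → trans residue (cong (λ f → suc f % 3) f≡0))
                    (λ f≡2 → trans residue (cong (λ f → suc f % 3) f≡2)) f≡0∨2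

corollary5 : (p : ℕ) → .{{_ : NonZero p}} → Prime p → p % 6 ≡ 1 →
    (a : ℕ) → 0 < a → a < p →
    (N p a % 6 ≡ 0) ⊎ (N p a % 6 ≡ 4)
corollary5 p p-prime p%6≡1 a 0<a a<p =
  subst (λ n → suc n % 6 ≡ 0 ⊎ suc n % 6 ≡ 4) (sym (𝔽².count-cong _ _ (OnCurve≐E a)))
    (suc-mod-6 (proj₁ count-E-odd) f k (proj₂ count-E-odd) E≡f+3k f≡0∨2)
  where
  open PrimeField p p-prime
  open Curve (p≡1[6]⇒3<p p-prime p%6≡1) (ℤ.+ a) (nonzero-residue 0<a a<p)
  ω = cube-root-of-unity (p≡1[6]⇒p≡1[3] p p%6≡1)
  E-mod-3 = count-E-mod-3 (proj₁ (proj₂ ω)) (proj₂ (proj₂ ω))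
  f = proj₁ E-mod-3
  k = proj₁ (proj₂ E-mod-3)
  E≡f+3k = proj₁ (proj₂ (proj₂ E-mod-3))
  f≡0∨2 = proj₂ (proj₂ (proj₂ E-mod-3))
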